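{- Let $\Delta$ be a positive integer and let $G$ be a graph of maximum degree at most $\Delta$. Let $L=\{v \in V(G): \deg_G(v) \le \Delta^{1/3}\}$. Then there is a proper conflict-free colouring of the induced subgraph $G[L]$ using at most $2\Delta^{1/3}+1$ colours such that for every vertex $v$ of $G$ with at least one neighbour in $L$, there is some $w \in N_G(v) \cap L$ whose colour appears on no other vertex of $N_G(v)\cap L$.
   Context: $N_G(v)$ denotes the set of neighbours of $v$ in $G$. A proper colouring assigns different colours to adjacent vertices. A proper conflict-free colouring of a graph $F$ is a proper colouring of $F$ such that for every non-isolated vertex $v$ of $F$, some neighbour of $v$ in $F$ receives a colour received by no other neighbour of $v$ in $F$. -}

module Defs where

open import Data.Nat using (ℕ; _≤_; _*_; _^_; _∸_)
open import Data.Fin using (Fin)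
open import Data.Bool using (Bool; T)
open import Data.List using (length; filterᵇ; allFin)
open import Data.Product using (Σ; _×_; ∃-syntax)
open import Relation.Nullary using (¬_)
open import Relation.Binary.PropositionalEquality using (_≡_)

record Graph (n : ℕ) : Set where
  field
    adj   : Fin n → Fin n → Bool
    sym   : ∀ u v → adj u v ≡ adj v u
    irref : ∀ v → adj v v ≡ Bool.false
open Graph public

Adj : ∀ {n} → Graph n → Fin n → Fin n → Set
Adj G u v = T (adj G u v)

deg : ∀ {n} → Graph n → Fin n → ℕ
deg G v = length (filterᵇ (adj G v) (allFin _))

MaxDegAtMost : ∀ {n} → Graph n → ℕ → Set
MaxDegAtMost G Δ = ∀ v → deg G v ≤ Δ

-- v ∈ L  iff  deg v ≤ Δ^{1/3}  iff  (deg v)^3 ≤ Δ  (exact, in ℕ)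
InL : ∀ {n} → Graph n → ℕ → Fin n → Set
InL G Δ v = deg G v ^ 3 ≤ Δ

-- c ≤ 2 Δ^{1/3} + 1  iff  (c ∸ 1)^3 ≤ 8Δ  (exact for natural c)
FewColours : ℕ → ℕ → Set
FewColours c Δ = (c ∸ 1) ^ 3 ≤ 8 * Δ

ProperOn : ∀ {n c} → Graph n → (Fin n → Set) → (Fin n → Fin c) → Set
ProperOn G S col = ∀ u v → S u → S v → Adj G u v → ¬ (col u ≡ col v)

UniqueInNbhd : ∀ {n c} → Graph n → (Fin n → Set) → (Fin n → Fin c) → Fin n → Set
UniqueInNbhd G S col v =
  ∃[ w ] (Adj G v w × S w ×
    (∀ w' → Adj G v w' → S w' → ¬ (w' ≡ w) → ¬ (col w' ≡ col w)))

ProperCFOn : ∀ {n c} → Graph n → (Fin n → Set) → (Fin n → Fin c) → Set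
ProperCFOn G S col =
  ProperOn G S col ×
  (∀ v → S v → (∃[ u ] (Adj G v u × S u)) → UniqueInNbhd G S col v)

{-# OPTIONS --safe #-}
module Submission where

-- Let D = ⌊Δ^{1/3}⌋, so every vertex of L has degree at most D.  For each vertex
-- v with a neighbour in L, let the pivot of v be its least-indexed neighbour in L.
-- Colour L greedily in increasing order of index, each vertex u avoiding the
-- colours already given to its neighbours and to the pivots of its neighbours: at most
-- 2D colours are forbidden, so 2D + 1 colours suffice.  The colouring is proper,
-- and every other L-neighbour w of v comes after the pivot of v, so w avoided the
-- pivot's colour, which is therefore unique in N(v) ∩ L.

open import Defs
open import Data.Nat using (ℕ; _≤_)
open import Data.Fin using (Fin)
open import Data.Product using (Σ; _×_; ∃-syntax)

open import Data.Nat as ℕ using (zero; suc; z≤n; s≤s; _+_; _*_; _^_; _≤?_)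
open import Data.Nat.Properties
  using (≤-refl; ≤-trans; ≤-reflexive; ≤-<-trans; <⇒≤; ≮⇒≥; +-mono-≤; *-monoʳ-≤;
         m<1+n⇒m<n∨m≡n; m≤n⇒m<n∨m≡n; m<1+n⇒m≤n; module ≤-Reasoning)
open import Data.Nat.Solver using (module +-*-Solver)
open import Data.Fin as Fin using (toℕ; fromℕ<)
open import Data.Fin.Properties
  using (_≟_; any?; ¬∀⟶∃¬; ¬∀⟶∃¬-smallest; pigeonhole; toℕ-injective; toℕ-inject;
         toℕ-fromℕ<; toℕ<n; <-cmp; <⇒≢; ≤∧≢⇒<)
open import Data.Bool using (T)
open import Data.List using (List; []; _++_; map; lookup; length; filterᵇ; allFin)
open import Data.List.Properties using (length-++; length-map)
open import Data.List.Membership.Propositional using (_∈_; _∉_)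
open import Data.List.Membership.Propositional.Properties
  using (∈-filter⁺; ∈-allFin; ∈-map⁺; ∈-++⁺ˡ; ∈-++⁺ʳ)
open import Data.List.Relation.Unary.Any using (index)
open import Data.List.Relation.Unary.Any.Properties using (lookup-index)
open import Data.Vec.Functional using (updateAt)
open import Data.Vec.Functional.Properties using (updateAt-updates; updateAt-minimal)
open import Data.Product using (_,_; proj₁; proj₂; ∃)
open import Data.Sum using (inj₁; inj₂)
open import Function using (_∘_; const)
open import Level using (Level; 0ℓ)
open import Relation.Nullary using (¬_; yes; no; ¬?; contradiction)
open import Relation.Nullary.Decidable using (decidable-stable; _×-dec_; T?)
open import Relation.Unary using (Pred; Decidable)
open import Relation.Binary.Definitions using (tri<; tri≈; tri>)
open import Relation.Binary.PropositionalEquality as ≡ using (_≡_; _≢_; refl; trans; cong; subst; module ≡-Reasoning)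

private
  variable
    p : Level
    n k : ℕ

greatest : {P : Pred ℕ p} → Decidable P → ℕ → ℕ
greatest P? zero = zero
greatest P? (suc k) with P? (suc k)
... | yes _ = suc k
... | no _ = greatest P? k

greatest-satisfies : {P : Pred ℕ p} (P? : Decidable P) → P 0 → ∀ k → P (greatest P? k)
greatest-satisfies P? P0 zero = P0
greatest-satisfies P? P0 (suc k) with P? (suc k)
... | yes Pk = Pk
... | no _ = greatest-satisfies P? P0 k

greatest-maximal : {P : Pred ℕ p} (P? : Decidable P) → ∀ {d k} → d ≤ k → P d → d ≤ greatest P? k
greatest-maximal P? {k = zero} d≤0 _ = d≤0
greatest-maximal P? {d} {suc k} d≤1+k Pd with P? (suc k) | m≤n⇒m<n∨m≡n d≤1+k
... | yes _ | _ = d≤1+k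
... | no _ | inj₁ d<1+k = greatest-maximal P? (m<1+n⇒m≤n d<1+k) Pd
... | no ¬Pk | inj₂ refl = contradiction Pd ¬Pk

least-witness : {P : Pred (Fin n) p} → Decidable P → ∃ P → ∃ λ i → P i × (∀ j → P j → i Fin.≤ j)
least-witness {n} {P = P} P? (w , Pw) with ¬∀⟶∃¬-smallest n (¬_ ∘ P) (¬? ∘ P?) (λ ∀¬P → ∀¬P w Pw)
... | i , ¬¬Pi , noneBelow = i , decidable-stable (P? i) ¬¬Pi , λ j Pj → ≮⇒≥ (λ j<i →
  noneBelow (fromℕ< j<i) (subst P (≡.sym (toℕ-injective (trans (toℕ-inject _) (toℕ-fromℕ< j<i)))) Pj))

length<⇒∃∉ : ∀ {c} (xs : List (Fin c)) → length xs ℕ.< c → ∃ (_∉ xs)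
length<⇒∃∉ {c} xs short = ¬∀⟶∃¬ c (_∈ xs) (_∈? xs) covers⇒⊥
  where
  open import Data.List.Membership.DecPropositional (_≟_ {c}) using (_∈?_)
  covers⇒⊥ : ¬ (∀ x → x ∈ xs)
  covers⇒⊥ covers with pigeonhole short (λ x → index (covers x))
  ... | i , j , i<j , sameIndex = <⇒≢ i<j (begin
    i                            ≡⟨ lookup-index (covers i) ⟩
    lookup xs (index (covers i)) ≡⟨ cong (lookup xs) sameIndex ⟩
    lookup xs (index (covers j)) ≡⟨ ≡.sym (lookup-index (covers j)) ⟩
    j                            ∎)
    where open ≡-Reasoning

greedy-colouring : (N : Fin n → List (Fin n)) → (∀ u → length (N u) ≤ k) →
  Σ (Fin n → Fin (suc k)) λ g → ∀ u w → w ∈ N u → w Fin.< u → g u ≢ g w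
greedy-colouring {n} {k} N short = proj₁ (colourBelow n ≤-refl) , λ u → proj₂ (colourBelow n ≤-refl) u (toℕ<n u)
  where
  Colouring : Set
  Colouring = Fin n → Fin (suc k)

  Respects : Colouring → Fin n → Set
  Respects g u = ∀ w → w ∈ N u → w Fin.< u → g u ≢ g w

  respects-agree : ∀ {g g' u} → (∀ y → y Fin.≤ u → g' y ≡ g y) → Respects g u → Respects g' u
  respects-agree {g} {g'} {u} agree respects w w∈N w<u g'u≡g'w =
    respects w w∈N w<u (trans (≡.sym (agree u ≤-refl)) (trans g'u≡g'w (agree w (<⇒≤ w<u))))

  respects-fresh : ∀ g i {x} → x ∉ map g (N i) → Respects (updateAt g i (const x)) i
  respects-fresh g i {x} x∉ w w∈N w<i x≡gw = x∉ (subst (_∈ map g (N i)) (≡.sym x≡gw′) (∈-map⁺ g w∈N))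
    where
    x≡gw′ : x ≡ g w
    x≡gw′ = trans (≡.sym (updateAt-updates i g)) (trans x≡gw (updateAt-minimal w i g (<⇒≢ w<i)))

  colourBelow : ∀ m → m ≤ n → Σ Colouring λ g → ∀ u → toℕ u ℕ.< m → Respects g u
  colourBelow zero _ = const Fin.zero , λ _ ()
  colourBelow (suc m) m<n with colourBelow m (<⇒≤ m<n)
  ... | g , respectsBelow = g′ , respectsBelow′
    where
    i : Fin n
    i = fromℕ< m<n

    fresh : ∃ (_∉ map g (N i))
    fresh = length<⇒∃∉ (map g (N i)) (s≤s (≤-trans (≤-reflexive (length-map g (N i))) (short i)))

    g′ : Colouring
    g′ = updateAt g i (const (proj₁ fresh))

    below-i : ∀ {y} → toℕ y ℕ.< m → y Fin.< i
    below-i {y} y<m = subst (toℕ y ℕ.<_) (≡.sym (toℕ-fromℕ< m<n)) y<m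

    respectsBelow′ : ∀ u → toℕ u ℕ.< suc m → Respects g′ u
    respectsBelow′ u u<1+m with m<1+n⇒m<n∨m≡n u<1+m
    ... | inj₁ u<m = respects-agree
            (λ y y≤u → updateAt-minimal y i g (<⇒≢ (below-i (≤-<-trans y≤u u<m))))
            (respectsBelow u u<m)
    ... | inj₂ u≡m with toℕ-injective {i = u} {j = i} (trans u≡m (≡.sym (toℕ-fromℕ< m<n)))
    ...   | refl = respects-fresh g i (proj₂ fresh)

neighbours : Graph n → Fin n → List (Fin n)
neighbours G u = filterᵇ (adj G u) (allFin _)

∈-neighbours : (G : Graph n) → ∀ {u v} → Adj G u v → v ∈ neighbours G u
∈-neighbours G {u} {v} = ∈-filter⁺ (T? ∘ adj G u) (∈-allFin v)

Adj-sym : (G : Graph n) → ∀ {u v} → Adj G u v → Adj G v u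
Adj-sym G {u} {v} = subst T (sym G u v)

Adj-irrefl : (G : Graph n) → ∀ v → ¬ Adj G v v
Adj-irrefl G v = subst T (irref G v)

conflict-free-colouring : (G : Graph n) {S : Pred (Fin n) 0ℓ} → Decidable S →
  (D : ℕ) → (∀ u → S u → deg G u ≤ D) →
  Σ (Fin n → Fin (suc (D + D))) λ col →
    ProperOn G S col × (∀ v → (∃[ u ] (Adj G v u × S u)) → UniqueInNbhd G S col v)
conflict-free-colouring {n} G {S} S? D lowDegree = col , proper , unique
  where
  SNeighbour : Fin n → Fin n → Set
  SNeighbour v w = Adj G v w × S w

  SNeighbour? : ∀ v → Decidable (SNeighbour v)
  SNeighbour? v w = T? (adj G v w) ×-dec S? w

  pivot : Fin n → Fin n
  pivot v with any? (SNeighbour? v)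
  ... | yes hasS = proj₁ (least-witness (SNeighbour? v) hasS)
  ... | no _ = v

  pivot-least : ∀ v → ∃ (SNeighbour v) → SNeighbour v (pivot v) × (∀ w → SNeighbour v w → pivot v Fin.≤ w)
  pivot-least v hasS with any? (SNeighbour? v)
  ... | yes hasS′ = proj₂ (least-witness (SNeighbour? v) hasS′)
  ... | no noS = contradiction hasS noS

  constraints : Fin n → List (Fin n)
  constraints u with S? u
  ... | yes _ = neighbours G u ++ map pivot (neighbours G u)
  ... | no _ = []

  constraints-short : ∀ u → length (constraints u) ≤ D + D
  constraints-short u with S? u
  ... | yes u∈S = begin
    length (neighbours G u ++ map pivot (neighbours G u)) ≡⟨ length-++ (neighbours G u) ⟩
    deg G u + length (map pivot (neighbours G u))         ≡⟨ cong (deg G u +_) (length-map pivot (neighbours G u)) ⟩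
    deg G u + deg G u                                     ≤⟨ +-mono-≤ (lowDegree u u∈S) (lowDegree u u∈S) ⟩
    D + D                                                 ∎
    where open ≤-Reasoning
  ... | no _ = z≤n

  constrains : ∀ {u v} → S u → Adj G u v → v ∈ constraints u × pivot v ∈ constraints u
  constrains {u} u∈S uv with S? u
  ... | yes _ = ∈-++⁺ˡ (∈-neighbours G uv) , ∈-++⁺ʳ (neighbours G u) (∈-map⁺ pivot (∈-neighbours G uv))
  ... | no u∉S = contradiction u∈S u∉S

  col : Fin n → Fin (suc (D + D))
  col = proj₁ (greedy-colouring constraints constraints-short)

  separated : ∀ u w → w ∈ constraints u → w Fin.< u → col u ≢ col w
  separated = proj₂ (greedy-colouring constraints constraints-short)

  proper : ProperOn G S col
  proper u v u∈S v∈S uv with <-cmp u v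
  ... | tri< u<v _ _ = λ same → separated v u (proj₁ (constrains v∈S (Adj-sym G uv))) u<v (≡.sym same)
  ... | tri> _ _ v<u = separated u v (proj₁ (constrains u∈S uv)) v<u
  ... | tri≈ _ refl _ = contradiction uv (Adj-irrefl G u)

  unique : ∀ v → ∃ (SNeighbour v) → UniqueInNbhd G S col v
  unique v hasS with pivot-least v hasS
  ... | (vp , p∈S) , least = pivot v , vp , p∈S , λ w vw w∈S w≢p →
    separated w (pivot v) (proj₂ (constrains w∈S (Adj-sym G vw))) (≤∧≢⇒< (least w (vw , w∈S)) (w≢p ∘ ≡.sym))

double-cube : ∀ d → (d + d) ^ 3 ≡ 8 * d ^ 3
double-cube = solve 1 (λ d → (d :+ d) :^ 3 := con 8 :* d :^ 3) refl
  where open +-*-Solver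

lemma8 : (Δ : ℕ) → 1 ≤ Δ → (n : ℕ) → (G : Graph n) → MaxDegAtMost G Δ →
    ∃[ c ] (FewColours c Δ × Σ (Fin n → Fin c) λ col →
      ProperCFOn G (InL G Δ) col ×
      (∀ v → (∃[ u ] (Adj G v u × InL G Δ u)) → UniqueInNbhd G (InL G Δ) col v))
lemma8 Δ _ n G maxDeg =
  let col , proper , unique = conflict-free-colouring G (cube≤Δ? ∘ deg G) ∛Δ lowDegree
  in suc (∛Δ + ∛Δ) , fewColours , col , (proper , λ v _ → unique v) , unique
  where
  cube≤Δ? : Decidable (λ d → d ^ 3 ≤ Δ)
  cube≤Δ? d = d ^ 3 ≤? Δ

  ∛Δ : ℕ
  ∛Δ = greatest cube≤Δ? Δ

  lowDegree : ∀ u → InL G Δ u → deg G u ≤ ∛Δ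
  lowDegree u = greatest-maximal cube≤Δ? (maxDeg u)

  fewColours : (∛Δ + ∛Δ) ^ 3 ≤ 8 * Δ
  fewColours = ≤-trans (≤-reflexive (double-cube ∛Δ)) (*-monoʳ-≤ 8 (greatest-satisfies cube≤Δ? z≤n Δ))
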